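{- Let $G_n$ be a graph of order $n$ with Laplacian matrix $L(G_n)$, and let $p\ge 2$. Let $K_{1, p-1}\circ_{1}(G_{n}\vee K_1)$ be the graph obtained from the star $K_{1,p-1}$ and the join $G_n\vee K_1$ by identifying the center of $K_{1,p-1}$ with the vertex of $K_1$; call the identified vertex $u^{*}$. Write $M=(L(G_n)+I_n)^{ -1}$, with rows and columns indexed by $V(G_n)$. Then the resistance distances $r_{ij}$ in this graph are: (i) for $v_i=u^{*}$, $v_j\in V(K_{1,p-1})\setminus \{u^{*}\}$, $r_{ij}= 1$; (ii) for $v_i= u^{*}$, $v_j\in V(G_n)$, $r_{ij}= M_{jj}$; (iii) for distinct $v_i, v_j\in V(K_{1,p-1})\setminus \{u^{*}\}$, $r_{ij}= 2$; (iv) for $v_i\in V(K_{1,p-1})\setminus \{u^{*}\}$, $v_j\in V(G_n)$, $r_{ij}= 1+M_{jj}$; (v) for distinct $v_i, v_j\in V(G_n)$, $r_{ij}= M_{ii}+M_{jj}-2M_{ij}$.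
   Context: The join $G\vee H$ of disjoint graphs $G,H$ is obtained from $G\cup H$ by adding all edges between $V(G)$ and $V(H)$. The Laplacian of a graph is $L=D-A$. The resistance distance $r_{ij}$ between vertices of a connected graph is the effective resistance between them when every edge is a resistor of $1\Omega$; equivalently $r_{ij}=l^{\#}_{ii}+l^{\#}_{jj}-2l^{\#}_{ij}$ with $L^{\#}$ the group inverse of the Laplacian. -}

module Defs where

open import Data.Nat using (ℕ; zero; suc; _∸_)
open import Data.Fin using (Fin; zero; suc; splitAt; _↑ˡ_; _↑ʳ_)
open import Data.Fin.Properties using (_≟_)
open import Data.Bool using (Bool; true; false; if_then_else_)
open import Data.Sum using (_⊎_; inj₁; inj₂)
open import Data.Rational using (ℚ; 0ℚ; 1ℚ; _+_; _*_; -_; _-_)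
open import Relation.Nullary using (¬_; yes; no)
open import Relation.Binary.PropositionalEquality using (_≡_)

record Graph (n : ℕ) : Set where
  field
    adj    : Fin n → Fin n → Bool
    sym    : ∀ i j → adj i j ≡ adj j i
    irrefl : ∀ i → adj i i ≡ false
open Graph public

Mat : ℕ → Set
Mat n = Fin n → Fin n → ℚ

Σ : ∀ {n} → (Fin n → ℚ) → ℚ
Σ {zero}  f = 0ℚ
Σ {suc n} f = f zero + Σ (λ i → f (suc i))

_⊗_ : ∀ {n} → Mat n → Mat n → Mat n
(A ⊗ B) i j = Σ (λ k → A i k * B k j)

_⊕_ : ∀ {n} → Mat n → Mat n → Mat n
(A ⊕ B) i j = A i j + B i j

I : ∀ {n} → Mat n
I i j with i ≟ j
... | yes _ = 1ℚ
... | no  _ = 0ℚ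

_≋_ : ∀ {n} → Mat n → Mat n → Set
A ≋ B = ∀ i j → A i j ≡ B i j

b2q : Bool → ℚ
b2q true  = 1ℚ
b2q false = 0ℚ

laplacian : ∀ {n} → (Fin n → Fin n → Bool) → Mat n
laplacian a i j with i ≟ j
... | yes _ = Σ (λ k → b2q (a i k)) - b2q (a i i)
... | no  _ = - b2q (a i j)

IsInverse : ∀ {n} → Mat n → Mat n → Set
IsInverse A X = ((A ⊗ X) ≋ I) Data.Product.× ((X ⊗ A) ≋ I)
  where import Data.Product

record IsGroupInverse {n} (A X : Mat n) : Set where
  field
    axa : ((A ⊗ X) ⊗ A) ≋ A
    xax : ((X ⊗ A) ⊗ X) ≋ X
    comm : (A ⊗ X) ≋ (X ⊗ A)

-- Resistance distance computed from the group inverse X of the Laplacian.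
resistance : ∀ {n} → Mat n → Fin n → Fin n → ℚ
resistance X i j = X i i + X j j - (1ℚ + 1ℚ) * X i j

-- The graph K_{1,q} ∘₁ (G ∨ K₁) with q leaves.
-- Vertex set Fin (suc (q + n)):  zero = u* (centre = the K₁ vertex),
-- suc (l ↑ˡ n) = l-th leaf of the star,  suc (q ↑ʳ v) = vertex v of G.
compAdj : ∀ q {n} → Graph n → Fin (suc (q Data.Nat.+ n)) → Fin (suc (q Data.Nat.+ n)) → Bool
compAdj q G zero    zero    = false
compAdj q G zero    (suc j) = true
compAdj q G (suc i) zero    = true
compAdj q G (suc i) (suc j) with splitAt q i | splitAt q j
... | inj₂ a | inj₂ b = adj G a b
... | _      | _      = false

ustar : ∀ q n → Fin (suc (q Data.Nat.+ n))
ustar q n = zero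

leaf : ∀ {q} n → Fin q → Fin (suc (q Data.Nat.+ n))
leaf n l = suc (l ↑ˡ n)

gvert : ∀ q {n} → Fin n → Fin (suc (q Data.Nat.+ n))
gvert q v = suc (q ↑ʳ v)

-- Write r for the centre u*.  Deleting row and column r from the Laplacian L of the composite
-- graph leaves I ⊕ (L(G) + I); padding its inverse I ⊕ M with zeros at r gives a matrix Y with
-- L Y = I − e_r 𝟙ᵀ (row r of L Y is −𝟙ᵀ because M, like L(G) + I, has column sums 1).
-- Sandwiching L X L = L between Yᵀ and Y gives X_ab − X_ar − X_rb + X_rr = Y_ba − Y_ra for the
-- group inverse X.  The corrections on either side cancel in Z_aa + Z_bb − Z_ab − Z_ba, and X is
-- symmetric, so r_ab = Y_aa + Y_bb − Y_ab − Y_ba, which is read off the blocks of Y.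

module Submission where

open import Defs hiding (sym)
open import Data.Nat as ℕ using (ℕ; zero; suc; _≤_; _∸_)
open import Data.Fin using (Fin; zero; suc; splitAt; join; _↑ˡ_; _↑ʳ_)
open import Data.Fin.Properties
  using (_≟_; suc-injective; ↑ˡ-injective; ↑ʳ-injective; splitAt-↑ˡ; splitAt-↑ʳ; join-splitAt)
open import Data.Sum using (_⊎_; inj₁; inj₂)
open import Data.Product using (_×_; _,_)
open import Data.Bool using (Bool; false)
open import Data.Rational using (ℚ; 0ℚ; 1ℚ; _+_; _*_; -_; _-_)
open import Data.Rational.Properties
  using (+-identityˡ; +-identityʳ; +-inverseʳ; +-assoc; *-identityˡ; *-zeroˡ; *-zeroʳ; *-comm; *-assoc; +-*-commutativeRing)
open import Data.Rational.Solver using (module +-*-Solver)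
open import Algebra.Bundles using (CommutativeRing)
open import Algebra.Properties.Semiring.Sum (CommutativeRing.semiring +-*-commutativeRing)
  using (sum; ∑-distrib-+; ∑-comm; *-distribˡ-sum)
open import Function.Definitions using (Injective)
open import Relation.Binary.Bundles using (Setoid)
open import Relation.Binary.PropositionalEquality using (_≡_; _≢_; refl; sym; trans; cong; cong₂; subst; module ≡-Reasoning)
open import Relation.Nullary using (yes; no; Dec)
open import Data.Empty using (⊥-elim)
import Relation.Binary.Reasoning.Setoid as SetoidReasoning

open +-*-Solver

Σ≡sum : ∀ {n} (f : Fin n → ℚ) → Σ f ≡ sum f
Σ≡sum {zero}  f = refl
Σ≡sum {suc n} f = cong (f zero +_) (Σ≡sum (λ i → f (suc i)))

Σ-cong : ∀ {n} {f g : Fin n → ℚ} → (∀ i → f i ≡ g i) → Σ f ≡ Σ g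
Σ-cong {zero}  e = refl
Σ-cong {suc n} e = cong₂ _+_ (e zero) (Σ-cong (λ i → e (suc i)))

Σ-zero : ∀ {n} {f : Fin n → ℚ} → (∀ i → f i ≡ 0ℚ) → Σ f ≡ 0ℚ
Σ-zero {zero}  e = refl
Σ-zero {suc n} e = cong₂ _+_ (e zero) (Σ-zero (λ i → e (suc i)))

Σ-distrib-+ : ∀ {n} (f g : Fin n → ℚ) → Σ (λ i → f i + g i) ≡ Σ f + Σ g
Σ-distrib-+ f g = begin
  Σ (λ i → f i + g i)  ≡⟨ Σ≡sum (λ i → f i + g i) ⟩
  sum (λ i → f i + g i) ≡⟨ ∑-distrib-+ f g ⟩
  sum f + sum g        ≡⟨ cong₂ _+_ (Σ≡sum f) (Σ≡sum g) ⟨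
  Σ f + Σ g            ∎
  where open ≡-Reasoning

Σ-distrib-- : ∀ {n} (f g : Fin n → ℚ) → Σ (λ i → f i - g i) ≡ Σ f - Σ g
Σ-distrib-- {zero}  f g = refl
Σ-distrib-- {suc n} f g =
  trans (cong (f zero - g zero +_) (Σ-distrib-- (λ i → f (suc i)) (λ i → g (suc i))))
        (solve 4 (λ a b c d → (a :- b) :+ (c :- d) := (a :+ c) :- (b :+ d)) refl
           (f zero) (g zero) (Σ (λ i → f (suc i))) (Σ (λ i → g (suc i))))

Σ-*ˡ : ∀ {n} (c : ℚ) (f : Fin n → ℚ) → Σ (λ i → c * f i) ≡ c * Σ f
Σ-*ˡ c f = begin
  Σ (λ i → c * f i)   ≡⟨ Σ≡sum (λ i → c * f i) ⟩
  sum (λ i → c * f i) ≡⟨ *-distribˡ-sum c f ⟨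
  c * sum f           ≡⟨ cong (c *_) (Σ≡sum f) ⟨
  c * Σ f             ∎
  where open ≡-Reasoning

Σ-*ʳ : ∀ {n} (c : ℚ) (f : Fin n → ℚ) → Σ (λ i → f i * c) ≡ Σ f * c
Σ-*ʳ c f = trans (Σ-cong (λ i → *-comm (f i) c)) (trans (Σ-*ˡ c f) (*-comm c (Σ f)))

Σ-comm : ∀ {m n} (f : Fin m → Fin n → ℚ) → Σ (λ i → Σ (λ j → f i j)) ≡ Σ (λ j → Σ (λ i → f i j))
Σ-comm f = begin
  Σ (λ i → Σ (λ j → f i j))     ≡⟨ trans (Σ-cong (λ i → Σ≡sum (f i))) (Σ≡sum (λ i → sum (f i))) ⟩
  sum (λ i → sum (λ j → f i j)) ≡⟨ ∑-comm f ⟩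
  sum (λ j → sum (λ i → f i j)) ≡⟨ trans (Σ-cong (λ j → Σ≡sum (λ i → f i j))) (Σ≡sum (λ j → sum (λ i → f i j))) ⟨
  Σ (λ j → Σ (λ i → f i j))     ∎
  where open ≡-Reasoning

Σ-↑ : ∀ m {n} (f : Fin (m ℕ.+ n) → ℚ) → Σ f ≡ Σ (λ i → f (i ↑ˡ n)) + Σ (λ j → f (m ↑ʳ j))
Σ-↑ zero    f = sym (+-identityˡ (Σ f))
Σ-↑ (suc m) f = trans (cong (f zero +_) (Σ-↑ m (λ i → f (suc i)))) (sym (+-assoc (f zero) _ _))

I-diag : ∀ {n} (i : Fin n) → I i i ≡ 1ℚ
I-diag i with i ≟ i
... | yes _  = refl
... | no i≢i = ⊥-elim (i≢i refl)

I-offdiag : ∀ {n} {i j : Fin n} → i ≢ j → I i j ≡ 0ℚ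
I-offdiag {i = i} {j} i≢j with i ≟ j
... | yes i≡j = ⊥-elim (i≢j i≡j)
... | no _    = refl

I-sym : ∀ {n} (i j : Fin n) → I i j ≡ I j i
I-sym i j with i ≟ j
... | yes refl = sym (I-diag i)
... | no i≢j   = sym (I-offdiag (λ j≡i → i≢j (sym j≡i)))

I-injective : ∀ {m n} {g : Fin m → Fin n} → Injective _≡_ _≡_ g → ∀ i j → I (g i) (g j) ≡ I i j
I-injective {g = g} g-inj i j with i ≟ j
... | yes refl = I-diag (g i)
... | no i≢j   = I-offdiag (λ gi≡gj → i≢j (g-inj gi≡gj))

Σ-I-* : ∀ {n} (i : Fin n) (f : Fin n → ℚ) → Σ (λ k → I i k * f k) ≡ f i
Σ-I-* {suc n} zero f = begin
  1ℚ * f zero + Σ (λ k → 0ℚ * f (suc k))  ≡⟨ cong₂ _+_ (*-identityˡ (f zero)) (Σ-zero (λ k → *-zeroˡ (f (suc k)))) ⟩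
  f zero + 0ℚ                             ≡⟨ +-identityʳ (f zero) ⟩
  f zero                                  ∎
  where open ≡-Reasoning
Σ-I-* {suc n} (suc i) f = begin
  0ℚ * f zero + Σ (λ k → I (suc i) (suc k) * f (suc k))
    ≡⟨ cong₂ _+_ (*-zeroˡ (f zero)) (Σ-cong (λ k → cong (_* f (suc k)) (I-injective suc-injective i k))) ⟩
  0ℚ + Σ (λ k → I i k * f (suc k))
    ≡⟨ +-identityˡ _ ⟩
  Σ (λ k → I i k * f (suc k))
    ≡⟨ Σ-I-* i (λ k → f (suc k)) ⟩
  f (suc i)
    ∎
  where open ≡-Reasoning

Σ-*-I : ∀ {n} (j : Fin n) (f : Fin n → ℚ) → Σ (λ k → f k * I k j) ≡ f j
Σ-*-I j f = trans (Σ-cong (λ k → trans (*-comm (f k) (I k j)) (cong (_* f k) (I-sym k j)))) (Σ-I-* j f)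

Σ-I : ∀ {n} (j : Fin n) → Σ (λ k → I k j) ≡ 1ℚ
Σ-I j = trans (Σ-cong (λ k → sym (*-identityˡ (I k j)))) (Σ-*-I j (λ _ → 1ℚ))

_ᵀ : ∀ {n} → Mat n → Mat n
(A ᵀ) i j = A j i

SymmetricMat : ∀ {n} → Mat n → Set
SymmetricMat A = (A ᵀ) ≋ A

≋-setoid : ℕ → Setoid _ _
≋-setoid n = record
  { Carrier       = Mat n
  ; _≈_           = _≋_
  ; isEquivalence = record
    { refl  = λ _ _ → refl
    ; sym   = λ A≋B i j → sym (A≋B i j)
    ; trans = λ A≋B B≋C i j → trans (A≋B i j) (B≋C i j)
    }
  }

module ≋-Reasoning {n : ℕ} = SetoidReasoning (≋-setoid n)

⊗-congˡ : ∀ {n} {A A′ : Mat n} (B : Mat n) → A ≋ A′ → (A ⊗ B) ≋ (A′ ⊗ B)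
⊗-congˡ B A≋A′ i j = Σ-cong (λ k → cong (_* B k j) (A≋A′ i k))

⊗-congʳ : ∀ {n} (A : Mat n) {B B′ : Mat n} → B ≋ B′ → (A ⊗ B) ≋ (A ⊗ B′)
⊗-congʳ A B≋B′ i j = Σ-cong (λ k → cong (A i k *_) (B≋B′ k j))

⊗-assoc : ∀ {n} (A B C : Mat n) → ((A ⊗ B) ⊗ C) ≋ (A ⊗ (B ⊗ C))
⊗-assoc A B C i j = begin
  Σ (λ k → Σ (λ m → A i m * B m k) * C k j)   ≡⟨ Σ-cong (λ k → sym (Σ-*ʳ (C k j) (λ m → A i m * B m k))) ⟩
  Σ (λ k → Σ (λ m → A i m * B m k * C k j))   ≡⟨ Σ-comm (λ k m → A i m * B m k * C k j) ⟩
  Σ (λ m → Σ (λ k → A i m * B m k * C k j))   ≡⟨ Σ-cong (λ m → Σ-cong (λ k → *-assoc (A i m) (B m k) (C k j))) ⟩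
  Σ (λ m → Σ (λ k → A i m * (B m k * C k j))) ≡⟨ Σ-cong (λ m → Σ-*ˡ (A i m) (λ k → B m k * C k j)) ⟩
  Σ (λ m → A i m * Σ (λ k → B m k * C k j))   ∎
  where open ≡-Reasoning

⊗-identityˡ : ∀ {n} (A : Mat n) → (I ⊗ A) ≋ A
⊗-identityˡ A i j = Σ-I-* i (λ k → A k j)

⊗-identityʳ : ∀ {n} (A : Mat n) → (A ⊗ I) ≋ A
⊗-identityʳ A i j = Σ-*-I j (A i)

ᵀ-cong : ∀ {n} {A B : Mat n} → A ≋ B → (A ᵀ) ≋ (B ᵀ)
ᵀ-cong A≋B i j = A≋B j i

I-symmetric : ∀ {n} → SymmetricMat (I {n})
I-symmetric i j = I-sym j i

⊗-ᵀ : ∀ {n} (A B : Mat n) → ((A ⊗ B) ᵀ) ≋ ((B ᵀ) ⊗ (A ᵀ))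
⊗-ᵀ A B i j = Σ-cong (λ k → *-comm (A j k) (B k i))

⊗-ᵀ₃ : ∀ {n} (A B C : Mat n) → (((A ⊗ B) ⊗ C) ᵀ) ≋ (((C ᵀ) ⊗ (B ᵀ)) ⊗ (A ᵀ))
⊗-ᵀ₃ A B C = begin
  ((A ⊗ B) ⊗ C) ᵀ             ≈⟨ ⊗-ᵀ (A ⊗ B) C ⟩
  (C ᵀ) ⊗ ((A ⊗ B) ᵀ)         ≈⟨ ⊗-congʳ (C ᵀ) (⊗-ᵀ A B) ⟩
  (C ᵀ) ⊗ ((B ᵀ) ⊗ (A ᵀ))     ≈⟨ ⊗-assoc (C ᵀ) (B ᵀ) (A ᵀ) ⟨
  ((C ᵀ) ⊗ (B ᵀ)) ⊗ (A ᵀ)     ∎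
  where open ≋-Reasoning

inverse-symmetric : ∀ {n} {A M : Mat n} → SymmetricMat A → IsInverse A M → SymmetricMat M
inverse-symmetric {A = A} {M} A-sym (_ , MA≋I) = begin
  M ᵀ               ≈⟨ ⊗-identityˡ (M ᵀ) ⟨
  I ⊗ (M ᵀ)         ≈⟨ ⊗-congˡ (M ᵀ) MA≋I ⟨
  (M ⊗ A) ⊗ (M ᵀ)   ≈⟨ ⊗-assoc M A (M ᵀ) ⟩
  M ⊗ (A ⊗ (M ᵀ))   ≈⟨ ⊗-congʳ M AMᵀ≋I ⟩
  M ⊗ I             ≈⟨ ⊗-identityʳ M ⟩
  M                 ∎
  where
  open ≋-Reasoning
  AMᵀ≋I : (A ⊗ (M ᵀ)) ≋ I
  AMᵀ≋I = begin
    A ⊗ (M ᵀ)       ≈⟨ ⊗-congˡ (M ᵀ) A-sym ⟨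
    (A ᵀ) ⊗ (M ᵀ)   ≈⟨ ⊗-ᵀ M A ⟨
    (M ⊗ A) ᵀ       ≈⟨ ᵀ-cong MA≋I ⟩
    I ᵀ             ≈⟨ I-symmetric ⟩
    I               ∎

module _ {n : ℕ} where
  open ≋-Reasoning {n}

  groupInverse-cong : {A B X : Mat n} → A ≋ B → IsGroupInverse A X → IsGroupInverse B X
  groupInverse-cong {A} {B} {X} A≋B gi = record
    { axa = begin
        (B ⊗ X) ⊗ B   ≈⟨ ⊗-congʳ (B ⊗ X) A≋B ⟨
        (B ⊗ X) ⊗ A   ≈⟨ ⊗-congˡ A (⊗-congˡ X A≋B) ⟨
        (A ⊗ X) ⊗ A   ≈⟨ axa ⟩
        A             ≈⟨ A≋B ⟩
        B             ∎
    ; xax = begin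
        (X ⊗ B) ⊗ X   ≈⟨ ⊗-congˡ X (⊗-congʳ X A≋B) ⟨
        (X ⊗ A) ⊗ X   ≈⟨ xax ⟩
        X             ∎
    ; comm = begin
        B ⊗ X         ≈⟨ ⊗-congˡ X A≋B ⟨
        A ⊗ X         ≈⟨ comm ⟩
        X ⊗ A         ≈⟨ ⊗-congʳ X A≋B ⟩
        X ⊗ B         ∎
    }
    where open IsGroupInverse gi

  groupInverse-ᵀ : {A X : Mat n} → IsGroupInverse A X → IsGroupInverse (A ᵀ) (X ᵀ)
  groupInverse-ᵀ {A} {X} gi = record
    { axa  = λ i j → trans (sym (⊗-ᵀ₃ A X A i j)) (axa j i)
    ; xax  = λ i j → trans (sym (⊗-ᵀ₃ X A X i j)) (xax j i)
    ; comm = begin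
        (A ᵀ) ⊗ (X ᵀ)   ≈⟨ ⊗-ᵀ X A ⟨
        (X ⊗ A) ᵀ       ≈⟨ ᵀ-cong comm ⟨
        (A ⊗ X) ᵀ       ≈⟨ ⊗-ᵀ A X ⟩
        (X ᵀ) ⊗ (A ᵀ)   ∎
    }
    where open IsGroupInverse gi

  groupInverse-unique : {A X Y : Mat n} → IsGroupInverse A X → IsGroupInverse A Y → X ≋ Y
  groupInverse-unique {A} {X} {Y} gx gy = begin
    X                 ≈⟨ X.xax ⟨
    (X ⊗ A) ⊗ X       ≈⟨ ⊗-assoc X A X ⟩
    X ⊗ (A ⊗ X)       ≈⟨ ⊗-congʳ X AX≋AY ⟩
    X ⊗ (A ⊗ Y)       ≈⟨ ⊗-assoc X A Y ⟨
    (X ⊗ A) ⊗ Y       ≈⟨ ⊗-congˡ Y X.comm ⟨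
    (A ⊗ X) ⊗ Y       ≈⟨ ⊗-congˡ Y AX≋AY ⟩
    (A ⊗ Y) ⊗ Y       ≈⟨ ⊗-congˡ Y Y.comm ⟩
    (Y ⊗ A) ⊗ Y       ≈⟨ Y.xax ⟩
    Y                 ∎
    where
    module X = IsGroupInverse gx
    module Y = IsGroupInverse gy
    AX≋AY : (A ⊗ X) ≋ (A ⊗ Y)
    AX≋AY = begin
      A ⊗ X                 ≈⟨ ⊗-congˡ X Y.axa ⟨
      ((A ⊗ Y) ⊗ A) ⊗ X     ≈⟨ ⊗-congˡ X (⊗-congˡ A Y.comm) ⟩
      ((Y ⊗ A) ⊗ A) ⊗ X     ≈⟨ ⊗-assoc (Y ⊗ A) A X ⟩
      (Y ⊗ A) ⊗ (A ⊗ X)     ≈⟨ ⊗-assoc Y A (A ⊗ X) ⟩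
      Y ⊗ (A ⊗ (A ⊗ X))     ≈⟨ ⊗-congʳ Y (⊗-congʳ A X.comm) ⟩
      Y ⊗ (A ⊗ (X ⊗ A))     ≈⟨ ⊗-congʳ Y (⊗-assoc A X A) ⟨
      Y ⊗ ((A ⊗ X) ⊗ A)     ≈⟨ ⊗-congʳ Y X.axa ⟩
      Y ⊗ A                 ≈⟨ Y.comm ⟨
      A ⊗ Y                 ∎

  groupInverse-symmetric : {A X : Mat n} → SymmetricMat A → IsGroupInverse A X → SymmetricMat X
  groupInverse-symmetric A-sym gi = groupInverse-unique (groupInverse-cong A-sym (groupInverse-ᵀ gi)) gi

degree : ∀ {n} → (Fin n → Fin n → Bool) → Fin n → ℚ
degree a i = Σ (λ k → b2q (a i k))

laplacian-entry : ∀ {n} (a : Fin n → Fin n → Bool) i j → laplacian a i j ≡ I i j * degree a i - b2q (a i j)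
laplacian-entry a i j with i ≟ j
... | yes refl = cong (_- b2q (a i i)) (sym (*-identityˡ (degree a i)))
... | no _     = solve 2 (λ d x → :- x := con 0ℚ :* d :- x) refl (degree a i) (b2q (a i j))

laplacian-offdiag : ∀ {n} (a : Fin n → Fin n → Bool) {i j} → i ≢ j → laplacian a i j ≡ - b2q (a i j)
laplacian-offdiag a {i} {j} i≢j with i ≟ j
... | yes i≡j = ⊥-elim (i≢j i≡j)
... | no _    = refl

laplacian-symmetric : ∀ {n} {a : Fin n → Fin n → Bool} → (∀ i j → a i j ≡ a j i) → SymmetricMat (laplacian a)
laplacian-symmetric {a = a} a-sym i j = by-cases (i ≟ j)
  where
  by-cases : Dec (i ≡ j) → laplacian a j i ≡ laplacian a i j
  by-cases (yes refl) = refl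
  by-cases (no i≢j)   = begin
    laplacian a j i   ≡⟨ laplacian-offdiag a (λ j≡i → i≢j (sym j≡i)) ⟩
    - b2q (a j i)     ≡⟨ cong (λ x → - b2q x) (a-sym j i) ⟩
    - b2q (a i j)     ≡⟨ laplacian-offdiag a i≢j ⟨
    laplacian a i j   ∎
    where open ≡-Reasoning

laplacian-rowsum : ∀ {n} (a : Fin n → Fin n → Bool) i → Σ (laplacian a i) ≡ 0ℚ
laplacian-rowsum a i = begin
  Σ (laplacian a i)                                   ≡⟨ Σ-cong (laplacian-entry a i) ⟩
  Σ (λ j → I i j * degree a i - b2q (a i j))          ≡⟨ Σ-distrib-- (λ j → I i j * degree a i) (λ j → b2q (a i j)) ⟩
  Σ (λ j → I i j * degree a i) - degree a i           ≡⟨ cong (_- degree a i) (Σ-I-* i (λ _ → degree a i)) ⟩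
  degree a i - degree a i                             ≡⟨ +-inverseʳ (degree a i) ⟩
  0ℚ                                                  ∎
  where open ≡-Reasoning

inverse-colsum : ∀ {n} {A M : Mat n} → (∀ j → Σ (λ i → A i j) ≡ 1ℚ) → (A ⊗ M) ≋ I →
                 ∀ j → Σ (λ i → M i j) ≡ 1ℚ
inverse-colsum {A = A} {M} colsumA AM≋I j = begin
  Σ (λ k → M k j)                    ≡⟨ Σ-cong (λ k → sym (trans (cong (_* M k j) (colsumA k)) (*-identityˡ (M k j)))) ⟩
  Σ (λ k → Σ (λ i → A i k) * M k j)  ≡⟨ Σ-cong (λ k → sym (Σ-*ʳ (M k j) (λ i → A i k))) ⟩
  Σ (λ k → Σ (λ i → A i k * M k j))  ≡⟨ Σ-comm (λ k i → A i k * M k j) ⟩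
  Σ (λ i → (A ⊗ M) i j)              ≡⟨ Σ-cong (λ i → AM≋I i j) ⟩
  Σ (λ i → I i j)                    ≡⟨ Σ-I j ⟩
  1ℚ                                 ∎
  where open ≡-Reasoning

grounding : ∀ {n} → Fin n → Mat n
grounding r i j = I i j - I i r

groundingᵀ-⊗ : ∀ {n} (r : Fin n) (Z : Mat n) a b → ((grounding r ᵀ) ⊗ Z) a b ≡ Z a b - Z r b
groundingᵀ-⊗ r Z a b = begin
  Σ (λ k → (I k a - I k r) * Z k b)
    ≡⟨ Σ-cong (λ k → solve 3 (λ x y z → (x :- y) :* z := x :* z :- y :* z) refl (I k a) (I k r) (Z k b)) ⟩
  Σ (λ k → I k a * Z k b - I k r * Z k b)             ≡⟨ Σ-distrib-- (λ k → I k a * Z k b) (λ k → I k r * Z k b) ⟩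
  Σ (λ k → I k a * Z k b) - Σ (λ k → I k r * Z k b)   ≡⟨ cong₂ _-_ (select a) (select r) ⟩
  Z a b - Z r b                                       ∎
  where
  open ≡-Reasoning
  select : ∀ c → Σ (λ k → I k c * Z k b) ≡ Z c b
  select c = trans (Σ-cong (λ k → cong (_* Z k b) (I-sym k c))) (Σ-I-* c (λ k → Z k b))

⊗-grounding : ∀ {n} (r : Fin n) (Z : Mat n) a b → (Z ⊗ grounding r) a b ≡ Z a b - Z a r
⊗-grounding r Z a b = begin
  Σ (λ k → Z a k * (I k b - I k r))
    ≡⟨ Σ-cong (λ k → solve 3 (λ x y z → z :* (x :- y) := z :* x :- z :* y) refl (I k b) (I k r) (Z a k)) ⟩
  Σ (λ k → Z a k * I k b - Z a k * I k r)             ≡⟨ Σ-distrib-- (λ k → Z a k * I k b) (λ k → Z a k * I k r) ⟩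
  Σ (λ k → Z a k * I k b) - Σ (λ k → Z a k * I k r)   ≡⟨ cong₂ _-_ (Σ-*-I b (Z a)) (Σ-*-I r (Z a)) ⟩
  Z a b - Z a r                                       ∎
  where open ≡-Reasoning

Δ : ∀ {n} → Mat n → Fin n → Fin n → ℚ
Δ Z a b = Z a a + Z b b - Z a b - Z b a

Δ-entries : ∀ {n} (Z : Mat n) a b {w x y z} →
            Z a a ≡ w → Z b b ≡ x → Z a b ≡ y → Z b a ≡ z → Δ Z a b ≡ w + x - y - z
Δ-entries Z a b refl refl refl refl = refl

Δ-cong : ∀ {n} {Z Z′ : Mat n} → Z ≋ Z′ → ∀ a b → Δ Z a b ≡ Δ Z′ a b
Δ-cong {Z = Z} Z≋Z′ a b = Δ-entries Z a b (Z≋Z′ a a) (Z≋Z′ b b) (Z≋Z′ a b) (Z≋Z′ b a)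

resistance-Δ : ∀ {n} {X : Mat n} → SymmetricMat X → ∀ a b → resistance X a b ≡ Δ X a b
resistance-Δ {X = X} X-sym a b = begin
  X a a + X b b - (1ℚ + 1ℚ) * X a b
    ≡⟨ solve 3 (λ x y z → x :+ y :- (con 1ℚ :+ con 1ℚ) :* z := x :+ y :- z :- z) refl (X a a) (X b b) (X a b) ⟩
  X a a + X b b - X a b - X a b
    ≡⟨ cong (λ x → X a a + X b b - X a b - x) (X-sym b a) ⟩
  X a a + X b b - X a b - X b a
    ∎
  where open ≡-Reasoning

Δ-centre : ∀ {n} (r : Fin n) (Z : Mat n) a b → Δ (λ i j → (Z i j - Z i r) - (Z r j - Z r r)) a b ≡ Δ Z a b
Δ-centre r Z a b =
  solve 9 (λ zaa zbb zab zba zar zra zbr zrb zrr →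
               (zaa :- zar :- (zra :- zrr)) :+ (zbb :- zbr :- (zrb :- zrr))
            :- (zab :- zar :- (zrb :- zrr)) :- (zba :- zbr :- (zra :- zrr))
          := zaa :+ zbb :- zab :- zba)
    refl (Z a a) (Z b b) (Z a b) (Z b a) (Z a r) (Z r a) (Z b r) (Z r b) (Z r r)

Δ-centreᵀ : ∀ {n} (r : Fin n) (Z : Mat n) a b → Δ (λ i j → Z j i - Z r i) a b ≡ Δ Z a b
Δ-centreᵀ r Z a b =
  solve 6 (λ zaa zbb zab zba zra zrb →
             (zaa :- zra) :+ (zbb :- zrb) :- (zba :- zra) :- (zab :- zrb) := zaa :+ zbb :- zab :- zba)
    refl (Z a a) (Z b b) (Z a b) (Z b a) (Z r a) (Z r b)

module Grounded {n : ℕ} {L X Y : Mat n} (r : Fin n) (L-sym : SymmetricMat L) (gi : IsGroupInverse L X)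
                (LY≋P : (L ⊗ Y) ≋ grounding r) where

  private
    P : Mat n
    P = grounding r

  sandwich : ((P ᵀ) ⊗ (X ⊗ P)) ≋ ((Y ᵀ) ⊗ P)
  sandwich = begin
    (P ᵀ) ⊗ (X ⊗ P)                 ≈⟨ ⊗-congʳ (P ᵀ) (⊗-congʳ X LY≋P) ⟨
    (P ᵀ) ⊗ (X ⊗ (L ⊗ Y))           ≈⟨ ⊗-congˡ (X ⊗ (L ⊗ Y)) YᵀL≋Pᵀ ⟨
    ((Y ᵀ) ⊗ L) ⊗ (X ⊗ (L ⊗ Y))     ≈⟨ ⊗-assoc (Y ᵀ) L (X ⊗ (L ⊗ Y)) ⟩
    (Y ᵀ) ⊗ (L ⊗ (X ⊗ (L ⊗ Y)))     ≈⟨ ⊗-congʳ (Y ᵀ) (⊗-assoc L X (L ⊗ Y)) ⟨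
    (Y ᵀ) ⊗ ((L ⊗ X) ⊗ (L ⊗ Y))     ≈⟨ ⊗-congʳ (Y ᵀ) (⊗-assoc (L ⊗ X) L Y) ⟨
    (Y ᵀ) ⊗ (((L ⊗ X) ⊗ L) ⊗ Y)     ≈⟨ ⊗-congʳ (Y ᵀ) (⊗-congˡ Y (IsGroupInverse.axa gi)) ⟩
    (Y ᵀ) ⊗ (L ⊗ Y)                 ≈⟨ ⊗-congʳ (Y ᵀ) LY≋P ⟩
    (Y ᵀ) ⊗ P                       ∎
    where
    open ≋-Reasoning
    YᵀL≋Pᵀ : ((Y ᵀ) ⊗ L) ≋ (P ᵀ)
    YᵀL≋Pᵀ = begin
      (Y ᵀ) ⊗ L         ≈⟨ ⊗-congʳ (Y ᵀ) L-sym ⟨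
      (Y ᵀ) ⊗ (L ᵀ)     ≈⟨ ⊗-ᵀ L Y ⟨
      (L ⊗ Y) ᵀ         ≈⟨ ᵀ-cong LY≋P ⟩
      P ᵀ               ∎

  potential : ∀ a b → Y b a - Y r a ≡ (X a b - X a r) - (X r b - X r r)
  potential a b = begin
    Y b a - Y r a                     ≡⟨ ⊗-grounding r (Y ᵀ) a b ⟨
    ((Y ᵀ) ⊗ P) a b                   ≡⟨ sandwich a b ⟨
    ((P ᵀ) ⊗ (X ⊗ P)) a b             ≡⟨ groundingᵀ-⊗ r (X ⊗ P) a b ⟩
    (X ⊗ P) a b - (X ⊗ P) r b         ≡⟨ cong₂ _-_ (⊗-grounding r X a b) (⊗-grounding r X r b) ⟩
    (X a b - X a r) - (X r b - X r r) ∎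
    where open ≡-Reasoning

  resistance-grounded : ∀ a b → resistance X a b ≡ Δ Y a b
  resistance-grounded a b = begin
    resistance X a b                                        ≡⟨ resistance-Δ (groupInverse-symmetric L-sym gi) a b ⟩
    Δ X a b                                                 ≡⟨ Δ-centre r X a b ⟨
    Δ (λ i j → (X i j - X i r) - (X r j - X r r)) a b       ≡⟨ Δ-cong potential a b ⟨
    Δ (λ i j → Y j i - Y r i) a b                           ≡⟨ Δ-centreᵀ r Y a b ⟩
    Δ Y a b                                                 ∎
    where open ≡-Reasoning

module Composite (q : ℕ) {n : ℕ} (G : Graph n) where

  data Vertex : Fin (suc (q ℕ.+ n)) → Set where
    centre : Vertex (ustar q n)
    leafᵛ  : (l : Fin q) → Vertex (leaf n l)
    gvertᵛ : (v : Fin n) → Vertex (gvert q v)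

  vertex : ∀ i → Vertex i
  vertex zero    = centre
  vertex (suc i) = subst (λ k → Vertex (suc k)) (join-splitAt q n i) (fromSplit (splitAt q i))
    where
    fromSplit : (s : Fin q ⊎ Fin n) → Vertex (suc (join q n s))
    fromSplit (inj₁ l) = leafᵛ l
    fromSplit (inj₂ v) = gvertᵛ v

  leaf≢gvert : ∀ l v → leaf n l ≢ gvert q v
  leaf≢gvert l v e with trans (sym (splitAt-↑ˡ q l n)) (trans (cong (splitAt q) (suc-injective e)) (splitAt-↑ʳ q n v))
  ... | ()

  leaf-injective : Injective _≡_ _≡_ (leaf {q} n)
  leaf-injective e = ↑ˡ-injective n _ _ (suc-injective e)

  gvert-injective : Injective _≡_ _≡_ (gvert q {n})
  gvert-injective e = ↑ʳ-injective q _ _ (suc-injective e)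

  a : Fin (suc (q ℕ.+ n)) → Fin (suc (q ℕ.+ n)) → Bool
  a = compAdj q G

  adj-leaf-leaf : ∀ l l′ → a (leaf n l) (leaf n l′) ≡ false
  adj-leaf-leaf l l′ rewrite splitAt-↑ˡ q l n = refl

  adj-leaf-gvert : ∀ l v → a (leaf n l) (gvert q v) ≡ false
  adj-leaf-gvert l v rewrite splitAt-↑ˡ q l n = refl

  adj-gvert-leaf : ∀ v l → a (gvert q v) (leaf n l) ≡ false
  adj-gvert-leaf v l rewrite splitAt-↑ʳ q n v | splitAt-↑ˡ q l n = refl

  adj-gvert-gvert : ∀ u v → a (gvert q u) (gvert q v) ≡ adj G u v
  adj-gvert-gvert u v rewrite splitAt-↑ʳ q n u | splitAt-↑ʳ q n v = refl

  compAdj-sym : ∀ i j → a i j ≡ a j i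
  compAdj-sym i j with vertex i | vertex j
  ... | centre   | centre    = refl
  ... | centre   | leafᵛ _   = refl
  ... | centre   | gvertᵛ _  = refl
  ... | leafᵛ _  | centre    = refl
  ... | gvertᵛ _ | centre    = refl
  ... | leafᵛ l  | leafᵛ l′  = trans (adj-leaf-leaf l l′) (sym (adj-leaf-leaf l′ l))
  ... | leafᵛ l  | gvertᵛ v  = trans (adj-leaf-gvert l v) (sym (adj-gvert-leaf v l))
  ... | gvertᵛ v | leafᵛ l   = trans (adj-gvert-leaf v l) (sym (adj-leaf-gvert l v))
  ... | gvertᵛ u | gvertᵛ v  = trans (adj-gvert-gvert u v) (trans (Graph.sym G u v) (sym (adj-gvert-gvert v u)))

  degree-leaf : ∀ l → degree a (leaf n l) ≡ 1ℚ
  degree-leaf l = begin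
    1ℚ + Σ (λ k → b2q (a (leaf n l) (suc k)))
      ≡⟨ cong (1ℚ +_) (Σ-↑ q (λ k → b2q (a (leaf n l) (suc k)))) ⟩
    1ℚ + (Σ (λ l′ → b2q (a (leaf n l) (leaf n l′))) + Σ (λ v → b2q (a (leaf n l) (gvert q v))))
      ≡⟨ cong (1ℚ +_) (cong₂ _+_ (Σ-zero (λ l′ → cong b2q (adj-leaf-leaf l l′)))
                                 (Σ-zero (λ v → cong b2q (adj-leaf-gvert l v)))) ⟩
    1ℚ + (0ℚ + 0ℚ)
      ∎
    where open ≡-Reasoning

  degree-gvert : ∀ v → degree a (gvert q v) ≡ 1ℚ + degree (adj G) v
  degree-gvert v = begin
    1ℚ + Σ (λ k → b2q (a (gvert q v) (suc k)))
      ≡⟨ cong (1ℚ +_) (Σ-↑ q (λ k → b2q (a (gvert q v) (suc k)))) ⟩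
    1ℚ + (Σ (λ l → b2q (a (gvert q v) (leaf n l))) + Σ (λ w → b2q (a (gvert q v) (gvert q w))))
      ≡⟨ cong (1ℚ +_) (cong₂ _+_ (Σ-zero (λ l → cong b2q (adj-gvert-leaf v l)))
                                 (Σ-cong (λ w → cong b2q (adj-gvert-gvert v w)))) ⟩
    1ℚ + (0ℚ + degree (adj G) v)
      ≡⟨ cong (1ℚ +_) (+-identityˡ (degree (adj G) v)) ⟩
    1ℚ + degree (adj G) v
      ∎
    where open ≡-Reasoning

  L : Mat (suc (q ℕ.+ n))
  L = laplacian a

  A : Mat n
  A = laplacian (adj G) ⊕ I

  L-centre-row : ∀ k → L zero (suc k) ≡ - 1ℚ
  L-centre-row k = laplacian-offdiag a {zero} {suc k} (λ ())

  L-leaf-leaf : ∀ l l′ → L (leaf n l) (leaf n l′) ≡ I l l′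
  L-leaf-leaf l l′ = begin
    L (leaf n l) (leaf n l′)
      ≡⟨ laplacian-entry a (leaf n l) (leaf n l′) ⟩
    I (leaf n l) (leaf n l′) * degree a (leaf n l) - b2q (a (leaf n l) (leaf n l′))
      ≡⟨ cong₂ _-_ (cong₂ _*_ (I-injective leaf-injective l l′) (degree-leaf l)) (cong b2q (adj-leaf-leaf l l′)) ⟩
    I l l′ * 1ℚ - 0ℚ
      ≡⟨ solve 1 (λ x → x :* con 1ℚ :- con 0ℚ := x) refl (I l l′) ⟩
    I l l′
      ∎
    where open ≡-Reasoning

  L-leaf-gvert : ∀ l v → L (leaf n l) (gvert q v) ≡ 0ℚ
  L-leaf-gvert l v = trans (laplacian-offdiag a (leaf≢gvert l v)) (cong (λ x → - b2q x) (adj-leaf-gvert l v))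

  L-gvert-leaf : ∀ v l → L (gvert q v) (leaf n l) ≡ 0ℚ
  L-gvert-leaf v l = trans (laplacian-offdiag a (λ e → leaf≢gvert l v (sym e))) (cong (λ x → - b2q x) (adj-gvert-leaf v l))

  L-gvert-gvert : ∀ u v → L (gvert q u) (gvert q v) ≡ A u v
  L-gvert-gvert u v = begin
    L (gvert q u) (gvert q v)
      ≡⟨ laplacian-entry a (gvert q u) (gvert q v) ⟩
    I (gvert q u) (gvert q v) * degree a (gvert q u) - b2q (a (gvert q u) (gvert q v))
      ≡⟨ cong₂ _-_ (cong₂ _*_ (I-injective gvert-injective u v) (degree-gvert u)) (cong b2q (adj-gvert-gvert u v)) ⟩
    I u v * (1ℚ + degree (adj G) u) - b2q (adj G u v)
      ≡⟨ solve 3 (λ δ d x → δ :* (con 1ℚ :+ d) :- x := (δ :* d :- x) :+ δ) refl (I u v) (degree (adj G) u) (b2q (adj G u v)) ⟩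
    (I u v * degree (adj G) u - b2q (adj G u v)) + I u v
      ≡⟨ cong (_+ I u v) (laplacian-entry (adj G) u v) ⟨
    A u v
      ∎
    where open ≡-Reasoning

  A-symmetric : SymmetricMat A
  A-symmetric i j = cong₂ _+_ (laplacian-symmetric (Graph.sym G) i j) (I-symmetric i j)

  A-colsum : ∀ j → Σ (λ i → A i j) ≡ 1ℚ
  A-colsum j = begin
    Σ (λ i → laplacian (adj G) i j + I i j)
      ≡⟨ Σ-distrib-+ (λ i → laplacian (adj G) i j) (λ i → I i j) ⟩
    Σ (λ i → laplacian (adj G) i j) + Σ (λ i → I i j)
      ≡⟨ cong₂ _+_ (Σ-cong (λ i → laplacian-symmetric (Graph.sym G) j i)) (Σ-I j) ⟩
    Σ (laplacian (adj G) j) + 1ℚ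
      ≡⟨ cong (_+ 1ℚ) (laplacian-rowsum (adj G) j) ⟩
    0ℚ + 1ℚ
      ∎
    where open ≡-Reasoning

  groundedInverse : Mat n → Mat (suc (q ℕ.+ n))
  groundedInverse M zero    _       = 0ℚ
  groundedInverse M (suc i) zero    = 0ℚ
  groundedInverse M (suc i) (suc j) = block (splitAt q i) (splitAt q j)
    where
    block : Fin q ⊎ Fin n → Fin q ⊎ Fin n → ℚ
    block (inj₁ l) (inj₁ l′) = I l l′
    block (inj₂ u) (inj₂ v)  = M u v
    block _        _         = 0ℚ

  module _ (M : Mat n) where

    private
      Y : Mat (suc (q ℕ.+ n))
      Y = groundedInverse M

    Y-centre-column : ∀ i → Y i zero ≡ 0ℚ
    Y-centre-column zero    = refl
    Y-centre-column (suc i) = refl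

    Y-leaf-leaf : ∀ l l′ → Y (leaf n l) (leaf n l′) ≡ I l l′
    Y-leaf-leaf l l′ rewrite splitAt-↑ˡ q l n | splitAt-↑ˡ q l′ n = refl

    Y-leaf-gvert : ∀ l v → Y (leaf n l) (gvert q v) ≡ 0ℚ
    Y-leaf-gvert l v rewrite splitAt-↑ˡ q l n | splitAt-↑ʳ q n v = refl

    Y-gvert-leaf : ∀ v l → Y (gvert q v) (leaf n l) ≡ 0ℚ
    Y-gvert-leaf v l rewrite splitAt-↑ʳ q n v | splitAt-↑ˡ q l n = refl

    Y-gvert-gvert : ∀ u v → Y (gvert q u) (gvert q v) ≡ M u v
    Y-gvert-gvert u v rewrite splitAt-↑ʳ q n u | splitAt-↑ʳ q n v = refl

    ⊗-expand : ∀ i c → (L ⊗ Y) i c ≡ Σ (λ l → L i (leaf n l) * Y (leaf n l) c)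
                                   + Σ (λ v → L i (gvert q v) * Y (gvert q v) c)
    ⊗-expand i c = begin
      L i zero * 0ℚ + Σ (λ k → L i (suc k) * Y (suc k) c)
        ≡⟨ trans (cong (_+ Σ (λ k → L i (suc k) * Y (suc k) c)) (*-zeroʳ (L i zero))) (+-identityˡ _) ⟩
      Σ (λ k → L i (suc k) * Y (suc k) c)
        ≡⟨ Σ-↑ q (λ k → L i (suc k) * Y (suc k) c) ⟩
      Σ (λ l → L i (leaf n l) * Y (leaf n l) c) + Σ (λ v → L i (gvert q v) * Y (gvert q v) c)
        ∎
      where open ≡-Reasoning

    ⊗-centre-column : ∀ i → (L ⊗ Y) i zero ≡ 0ℚ
    ⊗-centre-column i = Σ-zero (λ k → trans (cong (L i k *_) (Y-centre-column k)) (*-zeroʳ (L i k)))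

    ⊗-leaf-column : ∀ i l → (L ⊗ Y) i (leaf n l) ≡ L i (leaf n l)
    ⊗-leaf-column i l = begin
      (L ⊗ Y) i (leaf n l)
        ≡⟨ ⊗-expand i (leaf n l) ⟩
      Σ (λ l′ → L i (leaf n l′) * Y (leaf n l′) (leaf n l)) + Σ (λ v → L i (gvert q v) * Y (gvert q v) (leaf n l))
        ≡⟨ cong₂ _+_ (Σ-cong (λ l′ → cong (L i (leaf n l′) *_) (Y-leaf-leaf l′ l)))
                     (Σ-zero (λ v → trans (cong (L i (gvert q v) *_) (Y-gvert-leaf v l)) (*-zeroʳ (L i (gvert q v))))) ⟩
      Σ (λ l′ → L i (leaf n l′) * I l′ l) + 0ℚ
        ≡⟨ trans (+-identityʳ _) (Σ-*-I l (λ l′ → L i (leaf n l′))) ⟩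
      L i (leaf n l)
        ∎
      where open ≡-Reasoning

    ⊗-gvert-column : ∀ i w → (L ⊗ Y) i (gvert q w) ≡ Σ (λ v → L i (gvert q v) * M v w)
    ⊗-gvert-column i w = begin
      (L ⊗ Y) i (gvert q w)
        ≡⟨ ⊗-expand i (gvert q w) ⟩
      Σ (λ l → L i (leaf n l) * Y (leaf n l) (gvert q w)) + Σ (λ v → L i (gvert q v) * Y (gvert q v) (gvert q w))
        ≡⟨ cong₂ _+_ (Σ-zero (λ l → trans (cong (L i (leaf n l) *_) (Y-leaf-gvert l w)) (*-zeroʳ (L i (leaf n l)))))
                     (Σ-cong (λ v → cong (L i (gvert q v) *_) (Y-gvert-gvert v w))) ⟩
      0ℚ + Σ (λ v → L i (gvert q v) * M v w)
        ≡⟨ +-identityˡ _ ⟩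
      Σ (λ v → L i (gvert q v) * M v w)
        ∎
      where open ≡-Reasoning

  L-leaf-column : ∀ i l → L i (leaf n l) ≡ grounding zero i (leaf n l)
  L-leaf-column i l with vertex i
  ... | centre   = L-centre-row (l ↑ˡ n)
  ... | leafᵛ l′ = trans (L-leaf-leaf l′ l) (sym (trans (+-identityʳ _) (I-injective leaf-injective l′ l)))
  ... | gvertᵛ v = trans (L-gvert-leaf v l) (sym (trans (+-identityʳ _) (I-offdiag (λ e → leaf≢gvert l v (sym e)))))

  L⊗M-gvert-column : ∀ {M} → (A ⊗ M) ≋ I →
                     ∀ i w → Σ (λ v → L i (gvert q v) * M v w) ≡ grounding zero i (gvert q w)
  L⊗M-gvert-column {M} AM≋I i w with vertex i
  ... | centre   = begin
    Σ (λ v → L zero (gvert q v) * M v w)   ≡⟨ Σ-cong (λ v → cong (_* M v w) (L-centre-row (q ↑ʳ v))) ⟩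
    Σ (λ v → - 1ℚ * M v w)                 ≡⟨ Σ-*ˡ (- 1ℚ) (λ v → M v w) ⟩
    - 1ℚ * Σ (λ v → M v w)                 ≡⟨ cong (- 1ℚ *_) (inverse-colsum A-colsum AM≋I w) ⟩
    - 1ℚ * 1ℚ                              ∎
    where open ≡-Reasoning
  ... | leafᵛ l  = begin
    Σ (λ v → L (leaf n l) (gvert q v) * M v w)  ≡⟨ Σ-zero (λ v → trans (cong (_* M v w) (L-leaf-gvert l v)) (*-zeroˡ (M v w))) ⟩
    0ℚ                                          ≡⟨ trans (+-identityʳ _) (I-offdiag (leaf≢gvert l w)) ⟨
    I (leaf n l) (gvert q w) - 0ℚ               ∎
    where open ≡-Reasoning
  ... | gvertᵛ u = begin
    Σ (λ v → L (gvert q u) (gvert q v) * M v w) ≡⟨ Σ-cong (λ v → cong (_* M v w) (L-gvert-gvert u v)) ⟩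
    (A ⊗ M) u w                                 ≡⟨ AM≋I u w ⟩
    I u w                                       ≡⟨ trans (+-identityʳ _) (I-injective gvert-injective u w) ⟨
    I (gvert q u) (gvert q w) - 0ℚ              ∎
    where open ≡-Reasoning

  laplacian-⊗-groundedInverse : ∀ {M} → IsInverse A M → (L ⊗ groundedInverse M) ≋ grounding zero
  laplacian-⊗-groundedInverse {M} (AM≋I , _) i j with vertex j
  ... | centre   = trans (⊗-centre-column M i) (sym (+-inverseʳ (I i zero)))
  ... | leafᵛ l  = trans (⊗-leaf-column M i l) (L-leaf-column i l)
  ... | gvertᵛ w = trans (⊗-gvert-column M i w) (L⊗M-gvert-column AM≋I i w)

  module Resistances {M : Mat n} (inv : IsInverse A M) {X : Mat (suc (q ℕ.+ n))} (gi : IsGroupInverse L X) where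

    private
      Y : Mat (suc (q ℕ.+ n))
      Y = groundedInverse M

    open Grounded {Y = Y} zero (laplacian-symmetric compAdj-sym) gi (laplacian-⊗-groundedInverse inv)

    Y-leaf-diag : ∀ l → Y (leaf n l) (leaf n l) ≡ 1ℚ
    Y-leaf-diag l = trans (Y-leaf-leaf M l l) (I-diag l)

    resistance-centre : ∀ i → resistance X (ustar q n) i ≡ Y i i
    resistance-centre i = begin
      resistance X zero i     ≡⟨ trans (resistance-grounded zero i) (Δ-entries Y zero i refl refl refl (Y-centre-column M i)) ⟩
      0ℚ + Y i i - 0ℚ - 0ℚ    ≡⟨ solve 1 (λ y → con 0ℚ :+ y :- con 0ℚ :- con 0ℚ := y) refl (Y i i) ⟩
      Y i i                   ∎
      where open ≡-Reasoning

    resistance-centre-leaf : ∀ l → resistance X (ustar q n) (leaf n l) ≡ 1ℚ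
    resistance-centre-leaf l = trans (resistance-centre (leaf n l)) (Y-leaf-diag l)

    resistance-centre-gvert : ∀ v → resistance X (ustar q n) (gvert q v) ≡ M v v
    resistance-centre-gvert v = trans (resistance-centre (gvert q v)) (Y-gvert-gvert M v v)

    resistance-leaf-leaf : ∀ l l′ → l ≢ l′ → resistance X (leaf n l) (leaf n l′) ≡ 1ℚ + 1ℚ
    resistance-leaf-leaf l l′ l≢l′ =
      trans (resistance-grounded (leaf n l) (leaf n l′))
            (Δ-entries Y (leaf n l) (leaf n l′) (Y-leaf-diag l) (Y-leaf-diag l′)
                                                  (trans (Y-leaf-leaf M l l′) (I-offdiag l≢l′))
                                                  (trans (Y-leaf-leaf M l′ l) (I-offdiag (λ e → l≢l′ (sym e)))))

    resistance-leaf-gvert : ∀ l v → resistance X (leaf n l) (gvert q v) ≡ 1ℚ + M v v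
    resistance-leaf-gvert l v = begin
      resistance X (leaf n l) (gvert q v)
        ≡⟨ resistance-grounded (leaf n l) (gvert q v) ⟩
      Δ Y (leaf n l) (gvert q v)
        ≡⟨ Δ-entries Y (leaf n l) (gvert q v) (Y-leaf-diag l) (Y-gvert-gvert M v v) (Y-leaf-gvert M l v) (Y-gvert-leaf M v l) ⟩
      1ℚ + M v v - 0ℚ - 0ℚ
        ≡⟨ solve 1 (λ m → con 1ℚ :+ m :- con 0ℚ :- con 0ℚ := con 1ℚ :+ m) refl (M v v) ⟩
      1ℚ + M v v
        ∎
      where open ≡-Reasoning

    resistance-gvert-gvert : ∀ v w → resistance X (gvert q v) (gvert q w) ≡ M v v + M w w - (1ℚ + 1ℚ) * M v w
    resistance-gvert-gvert v w = begin
      resistance X (gvert q v) (gvert q w)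
        ≡⟨ resistance-grounded (gvert q v) (gvert q w) ⟩
      Δ Y (gvert q v) (gvert q w)
        ≡⟨ Δ-entries Y (gvert q v) (gvert q w) (Y-gvert-gvert M v v) (Y-gvert-gvert M w w) (Y-gvert-gvert M v w)
                                                          (trans (Y-gvert-gvert M w v) (inverse-symmetric A-symmetric inv v w)) ⟩
      M v v + M w w - M v w - M v w
        ≡⟨ solve 3 (λ x y z → x :+ y :- z :- z := x :+ y :- (con 1ℚ :+ con 1ℚ) :* z) refl (M v v) (M w w) (M v w) ⟩
      M v v + M w w - (1ℚ + 1ℚ) * M v w
        ∎
      where open ≡-Reasoning

theorem3p3 : (n p : ℕ) → 2 ≤ p → (G : Graph n)
  → (X : Mat _) → IsGroupInverse (laplacian (compAdj (p ∸ 1) G)) X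
  → (M : Mat n) → IsInverse (laplacian (adj G) ⊕ I) M
  → ((l : Fin (p ∸ 1)) → resistance X (ustar (p ∸ 1) n) (leaf n l) ≡ 1ℚ)
  × ((v : Fin n) → resistance X (ustar (p ∸ 1) n) (gvert (p ∸ 1) v) ≡ M v v)
  × ((l l′ : Fin (p ∸ 1)) → l ≢ l′ → resistance X (leaf n l) (leaf n l′) ≡ 1ℚ + 1ℚ)
  × ((l : Fin (p ∸ 1)) (v : Fin n) → resistance X (leaf n l) (gvert (p ∸ 1) v) ≡ 1ℚ + M v v)
  × ((v w : Fin n) → v ≢ w → resistance X (gvert (p ∸ 1) v) (gvert (p ∸ 1) w) ≡ M v v + M w w - (1ℚ + 1ℚ) * M v w)
theorem3p3 n p _ G X gi M inv =
    resistance-centre-leaf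
  , resistance-centre-gvert
  , resistance-leaf-leaf
  , resistance-leaf-gvert
  , λ v w _ → resistance-gvert-gvert v w
  where open Composite.Resistances (p ∸ 1) G inv gi
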